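{- Let $\dot G\in\mathcal C_1\cup\mathcal C_4\cup\mathcal C_5$ be a connected, non-complete, $6$-regular and $2$ net-regular strongly regular signed graph with parameters $(n,6,a,b,c)$. Suppose that every triangle of $\dot G$ is balanced. Then: (1) $a\in\{0,1,2,3\}$ and $b\in\{ -2,0\}$; (2) if $a=0$, then any two vertices joined by a positive edge have no common neighbour; and if $b=0$, then any two vertices joined by a negative edge have no common neighbour.
   Context: Signed graphs. - A signed graph $\dot G=(G,\sigma)$ is a simple graph $G$ (the underlying graph) with a sign function $\sigma:E(G)\to\{\pm1\}$. - The adjacency matrix has entries $\sigma(v_iv_j)$ for adjacent pairs and $0$ otherwise. - Connected, complete and regular refer to $G$. - $\dot G$ is $\rho$ net-regular if every vertex has (number of positive incident edges) $-$ (number of negative incident edges) $=\rho$. - $\dot G$ is homogeneous if all edges have the same sign. - A triangle is balanced if the product of its edge signs is $+1$. Strongly regular signed graphs. - An SRSG is a signed graph on $n$ vertices, neither homogeneous complete nor edgeless, for which there are $r\in\mathbb N$ and $a,b,c\in\mathbb Z$ such that the entries of $A(\dot G)^2$ are: - $r$ on the diagonal; - $a$ for pairs joined by a positive edge; - $b$ for pairs joined by a negative edge; - $c$ for distinct non-adjacent pairs. - $(n,r,a,b,c)$ are its parameters. Classes of inhomogeneous SRSGs. - $\mathcal C_1$: $a=-b$, and either complete, or non-complete with $c\ne0$. - $\mathcal C_4$: $a\ne-b$, non-complete, $c=0$. - $\mathcal C_5$: $a\ne-b$, non-complete, $c\ne\frac{a+b}2$ and $c\neq0$. -}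

module Defs where

open import Data.Nat using (ℕ; zero; suc)
open import Data.Fin using (Fin; zero; suc)
open import Data.Integer using (ℤ; +_; -_; _+_; _*_; ∣_∣)
open import Data.Product using (_×_; Σ; ∃; _,_)
open import Data.Sum using (_⊎_)
open import Relation.Nullary using (¬_)
open import Relation.Binary.PropositionalEquality using (_≡_; _≢_)

sumFin : (n : ℕ) → (Fin n → ℤ) → ℤ
sumFin zero    f = + 0
sumFin (suc n) f = f zero + sumFin n (λ i → f (suc i))

record SignedGraph (n : ℕ) : Set where
  field
    A        : Fin n → Fin n → ℤ
    entries  : ∀ i j → (A i j ≡ + 0) ⊎ (A i j ≡ + 1) ⊎ (A i j ≡ - + 1)
    symm     : ∀ i j → A i j ≡ A j i
    loopless : ∀ i → A i i ≡ + 0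

module _ {n : ℕ} (G : SignedGraph n) where
  open SignedGraph G

  Adj : Fin n → Fin n → Set
  Adj i j = A i j ≢ + 0

  PosEdge : Fin n → Fin n → Set
  PosEdge i j = A i j ≡ + 1

  NegEdge : Fin n → Fin n → Set
  NegEdge i j = A i j ≡ - + 1

  A² : Fin n → Fin n → ℤ
  A² i j = sumFin n (λ k → A i k * A k j)

  degree : Fin n → ℤ
  degree i = sumFin n (λ j → + ∣ A i j ∣)

  Regular : ℕ → Set
  Regular r = ∀ i → degree i ≡ + r

  NetRegular : ℤ → Set
  NetRegular ρ = ∀ i → sumFin n (λ j → A i j) ≡ ρ

  data Reach : Fin n → Fin n → Set where
    here : ∀ {i} → Reach i i
    step : ∀ {i j k} → Adj i j → Reach j k → Reach i k

  Connected : Set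
  Connected = ∀ i j → Reach i j

  Complete : Set
  Complete = ∀ i j → i ≢ j → Adj i j

  Edgeless : Set
  Edgeless = ∀ i j → ¬ Adj i j

  Homogeneous : Set
  Homogeneous = (∀ i j → Adj i j → PosEdge i j) ⊎ (∀ i j → Adj i j → NegEdge i j)

  TrianglesBalanced : Set
  TrianglesBalanced = ∀ i j k → Adj i j → Adj j k → Adj k i →
                      A i j * A j k * A k i ≡ + 1

  IsSRSG : ℕ → ℤ → ℤ → ℤ → Set
  IsSRSG r a b c =
      ¬ (Homogeneous × Complete)
    × ¬ Edgeless
    × (∀ i → A² i i ≡ + r)
    × (∀ i j → PosEdge i j → A² i j ≡ a)
    × (∀ i j → NegEdge i j → A² i j ≡ b)
    × (∀ i j → i ≢ j → ¬ Adj i j → A² i j ≡ c)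

  InC₁ : ℤ → ℤ → ℤ → Set
  InC₁ a b c = ¬ Homogeneous × a ≡ - b × (Complete ⊎ (¬ Complete × c ≢ + 0))

  InC₄ : ℤ → ℤ → ℤ → Set
  InC₄ a b c = ¬ Homogeneous × a ≢ - b × ¬ Complete × c ≡ + 0

  -- c ≠ (a+b)/2 written as 2c ≠ a + b
  InC₅ : ℤ → ℤ → ℤ → Set
  InC₅ a b c = ¬ Homogeneous × a ≢ - b × ¬ Complete × (+ 2 * c ≢ a + b) × c ≢ + 0

  NoCommonNeighbour : Fin n → Fin n → Set
  NoCommonNeighbour i j = ∀ k → ¬ (Adj i k × Adj j k)

module Submission where

-- Write A = A⁺ − A⁻ and |A| = A⁺ + A⁻ for the positive and negative parts of the adjacency
-- matrix; the degree conditions make the rows of A⁺ and A⁻ sum to 4 and 2. Balance means that a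
-- walk i–k–j through a common neighbour of an edge ij carries the sign of ij, so on positive edges
-- A² = a is the number of common neighbours and on negative edges b is minus that number; this
-- gives a ≥ 0, b ≤ 0 and part (2). Entrywise A² ≤ A⁺² + A⁻² and A² ≥ −(A⁺A⁻ + A⁻A⁺), and counting
-- how the four positive and two negative neighbours can be shared gives b ≥ −2 and, averaged over
-- the positive neighbours of a vertex, 4a ≤ 12 + 2. If b = −1 every negative edge lies in exactly
-- one triangle, which has two negative edges: pairing them shows n is even, the positive edge of the
-- triangle shows a ≥ 1, and inclusion–exclusion on two neighbourhoods gives n ≥ 11. Summing a row of
-- A², whose row sums are 2 · 2, yields 4a + (n − 7)c = 0 with n − 7 odd and at least 5, which is
-- impossible for 1 ≤ a ≤ 3.

open import Defs
open import Data.Empty using (⊥; ⊥-elim)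
open import Data.Fin using (Fin; zero; suc)
open import Data.Fin.Properties using () renaming (_≟_ to _≟ᶠ_)
open import Data.Integer
  using (ℤ; +_; -[1+_]; -_; _+_; _-_; _*_; ∣_∣; _≤_; _<_; 0ℤ; 1ℤ; -1ℤ; +≤+; -≤-; +<+; nonNegative)
open import Data.Integer.Properties
open import Data.Integer.Tactic.RingSolver using (solve-∀)
open import Data.Integer.Divisibility.Signed using (_∣_; divides; ∣m∣n⇒∣m+n; ∣⇒∣ᵤ)
open import Data.Nat as ℕ using (ℕ; zero; suc; s≤s; z≤n)
import Data.Nat.Properties as ℕ
open import Data.Nat.Properties using (even≢odd)
import Data.Nat.Tactic.RingSolver as ℕS
import Data.Nat.Divisibility as ℕ
open import Data.Product using (_×_; _,_; ∃; proj₁; proj₂)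
open import Data.Sum using (_⊎_; inj₁; inj₂)
open import Function using (_∘_)
open import Relation.Binary.PropositionalEquality
open import Relation.Nullary using (¬_; Dec; yes; no)
open import Relation.Nullary.Decidable using (from-no)
open import Algebra.Properties.CommutativeSemigroup *-commutativeSemigroup
  using () renaming (x∙yz≈y∙xz to x*[y*z]≡y*[x*z])
open import Algebra.Properties.Semiring.Sum +-*-semiring
  using (sum; sum-syntax; sum-cong-≗; sum-replicate-zero; ∑-distrib-+; ∑-comm; *-distribˡ-sum; *-distribʳ-sum)

infix 10 _⁺ _⁻

_⁺ : ℤ → ℤ
(+ m) ⁺ = + m
-[1+ m ] ⁺ = 0ℤ

_⁻ : ℤ → ℤ
(+ m) ⁻ = 0ℤ
-[1+ m ] ⁻ = + suc m

0≤⁺ : ∀ x → 0ℤ ≤ x ⁺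
0≤⁺ (+ m) = +≤+ z≤n
0≤⁺ -[1+ m ] = ≤-refl

0≤⁻ : ∀ x → 0ℤ ≤ x ⁻
0≤⁻ (+ m) = ≤-refl
0≤⁻ -[1+ m ] = +≤+ z≤n

0≤* : ∀ {x y} → 0ℤ ≤ x → 0ℤ ≤ y → 0ℤ ≤ x * y
0≤* {+ m} {+ k} _ _ = subst (0ℤ ≤_) (pos-* m k) (+≤+ z≤n)

1≰0 : ¬ (1ℤ ≤ 0ℤ)
1≰0 (+≤+ ())

∣∣≡⁺+⁻ : ∀ x → + ∣ x ∣ ≡ x ⁺ + x ⁻
∣∣≡⁺+⁻ (+ m) = sym (+-identityʳ (+ m))
∣∣≡⁺+⁻ -[1+ m ] = refl

≡⁺-⁻ : ∀ x → x ≡ x ⁺ - x ⁻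
≡⁺-⁻ (+ m) = sym (+-identityʳ (+ m))
≡⁺-⁻ -[1+ m ] = refl

*≡⁺⁻-expansion : ∀ x y → x * y ≡ (x ⁺ * y ⁺ + x ⁻ * y ⁻) - (x ⁺ * y ⁻ + x ⁻ * y ⁺)
*≡⁺⁻-expansion x y = begin
  x * y                     ≡⟨ cong₂ _*_ (≡⁺-⁻ x) (≡⁺-⁻ y) ⟩
  (x ⁺ - x ⁻) * (y ⁺ - y ⁻) ≡⟨ expand (x ⁺) (x ⁻) (y ⁺) (y ⁻) ⟩
  (x ⁺ * y ⁺ + x ⁻ * y ⁻) - (x ⁺ * y ⁻ + x ⁻ * y ⁺) ∎
  where
  open ≡-Reasoning
  expand : ∀ p m p′ m′ → (p - m) * (p′ - m′) ≡ (p * p′ + m * m′) - (p * m′ + m * p′)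
  expand = solve-∀

*≤⁺*⁺+⁻*⁻ : ∀ x y → x * y ≤ x ⁺ * y ⁺ + x ⁻ * y ⁻
*≤⁺*⁺+⁻*⁻ x y = begin
  x * y     ≡⟨ *≡⁺⁻-expansion x y ⟩
  same - opp ≤⟨ i-j≤i same opp {{nonNegative (+-mono-≤ (0≤* (0≤⁺ x) (0≤⁻ y)) (0≤* (0≤⁻ x) (0≤⁺ y)))}} ⟩
  same      ∎
  where
  open ≤-Reasoning
  same = x ⁺ * y ⁺ + x ⁻ * y ⁻
  opp  = x ⁺ * y ⁻ + x ⁻ * y ⁺

-⁺*⁻+⁻*⁺≤* : ∀ x y → - (x ⁺ * y ⁻ + x ⁻ * y ⁺) ≤ x * y
-⁺*⁻+⁻*⁺≤* x y = begin
  - opp        ≤⟨ i≤j+i (- opp) same {{nonNegative (+-mono-≤ (0≤* (0≤⁺ x) (0≤⁺ y)) (0≤* (0≤⁻ x) (0≤⁻ y)))}} ⟩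
  same - opp   ≡⟨ *≡⁺⁻-expansion x y ⟨
  x * y        ∎
  where
  open ≤-Reasoning
  same = x ⁺ * y ⁺ + x ⁻ * y ⁻
  opp  = x ⁺ * y ⁻ + x ⁻ * y ⁺

data Entry : ℤ → Set where
  none : Entry 0ℤ
  pos  : Entry 1ℤ
  neg  : Entry -1ℤ

entry : ∀ {x} → x ≡ + 0 ⊎ x ≡ + 1 ⊎ x ≡ - + 1 → Entry x
entry (inj₁ refl) = none
entry (inj₂ (inj₁ refl)) = pos
entry (inj₂ (inj₂ refl)) = neg

entry-unit² : ∀ {x} → Entry x → x ≢ 0ℤ → x * x ≡ 1ℤ
entry-unit² none x≢0 = ⊥-elim (x≢0 refl)
entry-unit² pos  _   = refl
entry-unit² neg  _   = refl

entry-∣∣≡1 : ∀ {x} → Entry x → x ≢ 0ℤ → + ∣ x ∣ ≡ 1ℤ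
entry-∣∣≡1 none x≢0 = ⊥-elim (x≢0 refl)
entry-∣∣≡1 pos  _   = refl
entry-∣∣≡1 neg  _   = refl

entry-⁺≢0 : ∀ {x} → Entry x → x ⁺ ≢ 0ℤ → x ≡ 1ℤ
entry-⁺≢0 none x⁺≢0 = ⊥-elim (x⁺≢0 refl)
entry-⁺≢0 pos  _    = refl
entry-⁺≢0 neg  x⁺≢0 = ⊥-elim (x⁺≢0 refl)

entry-⁻≢0 : ∀ {x} → Entry x → x ⁻ ≢ 0ℤ → x ≡ -1ℤ
entry-⁻≢0 none x⁻≢0 = ⊥-elim (x⁻≢0 refl)
entry-⁻≢0 pos  x⁻≢0 = ⊥-elim (x⁻≢0 refl)
entry-⁻≢0 neg  _    = refl

entry-⁺*≤ : ∀ {x u} → Entry x → 0ℤ ≤ u → x ⁺ * u ≤ u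
entry-⁺*≤ none 0≤u = 0≤u
entry-⁺*≤ pos  _   = ≤-reflexive (*-identityˡ _)
entry-⁺*≤ neg  0≤u = 0≤u

entry-⁺-guard-≡ : ∀ {x u v} → Entry x → (x ≡ 1ℤ → u ≡ v) → x ⁺ * u ≡ x ⁺ * v
entry-⁺-guard-≡ none _ = refl
entry-⁺-guard-≡ pos  h = cong (1ℤ *_) (h refl)
entry-⁺-guard-≡ neg  _ = refl

entry-⁻-guard-≡ : ∀ {x u v} → Entry x → (x ≡ -1ℤ → u ≡ v) → x ⁻ * u ≡ x ⁻ * v
entry-⁻-guard-≡ none _ = refl
entry-⁻-guard-≡ pos  _ = refl
entry-⁻-guard-≡ neg  h = cong (1ℤ *_) (h refl)

entry-⁺-guard-≤ : ∀ {x u v} → Entry x → (x ≡ 1ℤ → u ≤ v) → x ⁺ * u ≤ x ⁺ * v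
entry-⁺-guard-≤ none _ = ≤-refl
entry-⁺-guard-≤ pos  h = *-monoˡ-≤-nonNeg 1ℤ (h refl)
entry-⁺-guard-≤ neg  _ = ≤-refl

entry-⁻-guard-≤ : ∀ {x u v} → Entry x → (x ≡ -1ℤ → u ≤ v) → x ⁻ * u ≤ x ⁻ * v
entry-⁻-guard-≤ none _ = ≤-refl
entry-⁻-guard-≤ pos  _ = ≤-refl
entry-⁻-guard-≤ neg  h = *-monoˡ-≤-nonNeg 1ℤ (h refl)

entries-∣∣+∣∣≤∣∣*∣∣+1 : ∀ {x y} → Entry x → Entry y → + ∣ y ∣ + + ∣ x ∣ ≤ + ∣ x ∣ * + ∣ y ∣ + 1ℤ
entries-∣∣+∣∣≤∣∣*∣∣+1 none none = ≤ᵇ⇒≤ _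
entries-∣∣+∣∣≤∣∣*∣∣+1 none pos  = ≤ᵇ⇒≤ _
entries-∣∣+∣∣≤∣∣*∣∣+1 none neg  = ≤ᵇ⇒≤ _
entries-∣∣+∣∣≤∣∣*∣∣+1 pos  none = ≤ᵇ⇒≤ _
entries-∣∣+∣∣≤∣∣*∣∣+1 pos  pos  = ≤ᵇ⇒≤ _
entries-∣∣+∣∣≤∣∣*∣∣+1 pos  neg  = ≤ᵇ⇒≤ _
entries-∣∣+∣∣≤∣∣*∣∣+1 neg  none = ≤ᵇ⇒≤ _
entries-∣∣+∣∣≤∣∣*∣∣+1 neg  pos  = ≤ᵇ⇒≤ _
entries-∣∣+∣∣≤∣∣*∣∣+1 neg  neg  = ≤ᵇ⇒≤ _

entries-*≡-1 : ∀ {x y} → Entry x → Entry y → x * y ≡ -1ℤ → x ≡ 1ℤ ⊎ y ≡ 1ℤ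
entries-*≡-1 pos _   _  = inj₁ refl
entries-*≡-1 neg pos _  = inj₂ refl
entries-*≡-1 none _  ()
entries-*≡-1 neg none ()
entries-*≡-1 neg neg ()

entries-opposite : ∀ {x y} → Entry x → Entry y → x * y ≡ -1ℤ * (+ ∣ x ∣ * + ∣ y ∣) →
                   + ∣ x ∣ * + ∣ y ∣ ≡ x ⁺ * y ⁻ + x ⁻ * y ⁺
entries-opposite none _    _  = refl
entries-opposite pos  none _  = refl
entries-opposite pos  neg  _  = refl
entries-opposite neg  none _  = refl
entries-opposite neg  pos  _  = refl
entries-opposite pos  pos  ()
entries-opposite neg  neg  ()

unit-walk : ∀ {s x y} → s * s ≡ 1ℤ → s * y * x ≡ 1ℤ → x * y ≡ s * 1ℤ
unit-walk {s} {x} {y} s²≡1 triangle = begin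
  x * y             ≡⟨ *-identityˡ (x * y) ⟨
  1ℤ * (x * y)      ≡⟨ cong (_* (x * y)) s²≡1 ⟨
  s * s * (x * y)   ≡⟨ regroup s x y ⟩
  s * (s * y * x)   ≡⟨ cong (s *_) triangle ⟩
  s * 1ℤ            ∎
  where
  open ≡-Reasoning
  regroup : ∀ s x y → s * s * (x * y) ≡ s * (s * y * x)
  regroup = solve-∀

-- s is the sign of an edge ij, x * y a walk i–k–j, and the premise is the balance of the triangle ijk.
balanced-walk : ∀ {s x y} → Entry x → Entry y → s * s ≡ 1ℤ →
                (x ≢ 0ℤ → y ≢ 0ℤ → s * y * x ≡ 1ℤ) → x * y ≡ s * (+ ∣ x ∣ * + ∣ y ∣)
balanced-walk {s} none _    _    _       = sym (*-zeroʳ s)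
balanced-walk {s} pos  none _    _       = sym (*-zeroʳ s)
balanced-walk {s} neg  none _    _       = sym (*-zeroʳ s)
balanced-walk {s} pos  pos  s²≡1 balance = unit-walk {s} s²≡1 (balance (λ ()) (λ ()))
balanced-walk {s} pos  neg  s²≡1 balance = unit-walk {s} s²≡1 (balance (λ ()) (λ ()))
balanced-walk {s} neg  pos  s²≡1 balance = unit-walk {s} s²≡1 (balance (λ ()) (λ ()))
balanced-walk {s} neg  neg  s²≡1 balance = unit-walk {s} s²≡1 (balance (λ ()) (λ ()))

entry-decomposition : ∀ {a b c x w} → Entry x → (x ≡ 0ℤ → w ≡ c) → (x ≡ 1ℤ → w ≡ a) → (x ≡ -1ℤ → w ≡ b) →
                      w + c * + ∣ x ∣ ≡ a * x ⁺ + b * x ⁻ + c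
entry-decomposition {a} {b} {c} none w≡c _ _ = trans (cong (λ w → w + c * 0ℤ) (w≡c refl)) (identity a b c)
  where identity : ∀ a b c → c + c * 0ℤ ≡ a * 0ℤ + b * 0ℤ + c
        identity = solve-∀
entry-decomposition {a} {b} {c} pos _ w≡a _ = trans (cong (λ w → w + c * 1ℤ) (w≡a refl)) (identity a b c)
  where identity : ∀ a b c → a + c * 1ℤ ≡ a * 1ℤ + b * 0ℤ + c
        identity = solve-∀
entry-decomposition {a} {b} {c} neg _ _ w≡b = trans (cong (λ w → w + c * 1ℤ) (w≡b refl)) (identity a b c)
  where identity : ∀ a b c → b + c * 1ℤ ≡ a * 0ℤ + b * 1ℤ + c
        identity = solve-∀

sumFin≡sum : ∀ n (f : Fin n → ℤ) → sumFin n f ≡ sum f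
sumFin≡sum zero    f = refl
sumFin≡sum (suc n) f = cong (λ s → f zero + s) (sumFin≡sum n (f ∘ suc))

sum-const : ∀ n x → sum {n} (λ _ → x) ≡ + n * x
sum-const zero    x = refl
sum-const (suc n) x = begin
  x + sum {n} (λ _ → x) ≡⟨ cong₂ _+_ (*-identityˡ x) (sym (sum-const n x)) ⟨
  1ℤ * x + + n * x      ≡⟨ *-distribʳ-+ x 1ℤ (+ n) ⟨
  + suc n * x           ∎
  where open ≡-Reasoning

sum-mono-≤ : ∀ {n} {f g : Fin n → ℤ} → (∀ i → f i ≤ g i) → sum f ≤ sum g
sum-mono-≤ {zero}  f≤g = ≤-refl
sum-mono-≤ {suc n} f≤g = +-mono-≤ (f≤g zero) (sum-mono-≤ (f≤g ∘ suc))

sum-mono-< : ∀ {n} {f g : Fin n → ℤ} → (∀ i → f i ≤ g i) → ∀ k → f k < g k → sum f < sum g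
sum-mono-< f≤g zero    fk<gk = +-mono-<-≤ fk<gk (sum-mono-≤ (f≤g ∘ suc))
sum-mono-< f≤g (suc k) fk<gk = +-mono-≤-< (f≤g zero) (sum-mono-< (f≤g ∘ suc) k fk<gk)

sum-nonNeg : ∀ {n} {f : Fin n → ℤ} → (∀ i → 0ℤ ≤ f i) → 0ℤ ≤ sum f
sum-nonNeg {n} {f} 0≤f = subst (_≤ sum f) (sum-replicate-zero n) (sum-mono-≤ {f = λ _ → 0ℤ} 0≤f)

term≤sum : ∀ {n} {f : Fin n → ℤ} → (∀ i → 0ℤ ≤ f i) → ∀ k → f k ≤ sum f
term≤sum {f = f} 0≤f zero    = i≤i+j (f zero) _ {{nonNegative (sum-nonNeg (0≤f ∘ suc))}}
term≤sum {f = f} 0≤f (suc k) = i≤j⇒i≤k+j (f zero) {{nonNegative (0≤f zero)}} (term≤sum (0≤f ∘ suc) k)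

sum≢0⇒∃≢0 : ∀ {n} {f : Fin n → ℤ} → sum f ≢ 0ℤ → ∃ λ k → f k ≢ 0ℤ
sum≢0⇒∃≢0 {zero}          sum≢0 = ⊥-elim (sum≢0 refl)
sum≢0⇒∃≢0 {suc n} {f = f} sum≢0 with f zero ≟ 0ℤ
... | no  f₀≢0 = zero , f₀≢0
... | yes f₀≡0 with sum≢0⇒∃≢0 (λ rest≡0 → sum≢0 (cong₂ _+_ f₀≡0 rest≡0))
...   | k , fk≢0 = suc k , fk≢0

sum-neg : ∀ {n} (f : Fin n → ℤ) → sum (λ k → - f k) ≡ - sum f
sum-neg f = begin
  sum (λ k → - f k)       ≡⟨ sum-cong-≗ (λ k → -1*i≡-i (f k)) ⟨
  sum (λ k → -1ℤ * f k)   ≡⟨ *-distribˡ-sum -1ℤ f ⟨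
  -1ℤ * sum f             ≡⟨ -1*i≡-i (sum f) ⟩
  - sum f                 ∎
  where open ≡-Reasoning

∣-sum : ∀ {d n} {f : Fin n → ℤ} → (∀ i → d ∣ f i) → d ∣ sum f
∣-sum {n = zero}  d∣f = divides 0ℤ refl
∣-sum {n = suc n} d∣f = ∣m∣n⇒∣m+n (d∣f zero) (∣-sum (d∣f ∘ suc))

2∣sum-symmetric : ∀ {n} (R : Fin n → Fin n → ℤ) → (∀ j k → R j k ≡ R k j) → (∀ j → R j j ≡ 0ℤ) →
                  + 2 ∣ ∑[ j < n ] ∑[ k < n ] R j k
2∣sum-symmetric {zero}  R symmetric hollow = divides 0ℤ refl
2∣sum-symmetric {suc n} R symmetric hollow =
  subst (+ 2 ∣_) (sym split) (∣m∣n⇒∣m+n (divides X (double X)) (2∣sum-symmetric R′ (λ j k → symmetric (suc j) (suc k)) (hollow ∘ suc)))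
  where
  open ≡-Reasoning
  R′ = λ j k → R (suc j) (suc k)
  X = ∑[ k < n ] R zero (suc k)
  double : ∀ x → x + x ≡ x * + 2
  double = solve-∀
  rearrange : ∀ x y → 0ℤ + x + (x + y) ≡ x + x + y
  rearrange = solve-∀
  split : ∑[ j < suc n ] ∑[ k < suc n ] R j k ≡ X + X + ∑[ j < n ] ∑[ k < n ] R′ j k
  split = begin
    R zero zero + X + ∑[ j < n ] (R (suc j) zero + ∑[ k < n ] R′ j k)
      ≡⟨ cong₂ _+_ (cong (_+ X) (hollow zero)) (∑-distrib-+ (λ j → R (suc j) zero) (λ j → ∑[ k < n ] R′ j k)) ⟩
    0ℤ + X + (∑[ j < n ] R (suc j) zero + ∑[ j < n ] ∑[ k < n ] R′ j k)
      ≡⟨ cong (λ t → 0ℤ + X + (t + ∑[ j < n ] ∑[ k < n ] R′ j k)) (sum-cong-≗ (λ j → symmetric (suc j) zero)) ⟩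
    0ℤ + X + (X + ∑[ j < n ] ∑[ k < n ] R′ j k)
      ≡⟨ rearrange X _ ⟩
    X + X + ∑[ j < n ] ∑[ k < n ] R′ j k ∎

δ : ∀ {n} → Fin n → Fin n → ℤ
δ zero    zero    = 1ℤ
δ zero    (suc _) = 0ℤ
δ (suc _) zero    = 0ℤ
δ (suc i) (suc j) = δ i j

δ-diag : ∀ {n} (i : Fin n) → δ i i ≡ 1ℤ
δ-diag zero    = refl
δ-diag (suc i) = δ-diag i

δ-offdiag : ∀ {n} {i j : Fin n} → i ≢ j → δ i j ≡ 0ℤ
δ-offdiag {i = zero}  {zero}  i≢j = ⊥-elim (i≢j refl)
δ-offdiag {i = zero}  {suc j} _   = refl
δ-offdiag {i = suc i} {zero}  _   = refl
δ-offdiag {i = suc i} {suc j} i≢j = δ-offdiag (i≢j ∘ cong suc)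

sum-δ : ∀ {n} (i : Fin n) → sum (δ i) ≡ 1ℤ
sum-δ {suc n} zero    = cong (_+_ 1ℤ) (sum-replicate-zero n)
sum-δ {suc n} (suc i) = trans (+-identityˡ _) (sum-δ i)

odd*suc≢4* : ∀ r d k → 2 ℕ.≤ r → k ℕ.≤ 3 → suc (2 ℕ.* r) ℕ.* suc d ≢ 4 ℕ.* k
odd*suc≢4* r zero k _ _ eq = even≢odd (2 ℕ.* k) r (sym (begin
  suc (2 ℕ.* r)            ≡⟨ ℕ.*-identityʳ _ ⟨
  suc (2 ℕ.* r) ℕ.* 1      ≡⟨ eq ⟩
  4 ℕ.* k                  ≡⟨ ℕ.*-assoc 2 2 k ⟩
  2 ℕ.* (2 ℕ.* k)          ∎))
  where open ≡-Reasoning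
odd*suc≢4* r (suc zero) k _ _ eq = even≢odd k r (sym (ℕ.*-cancelˡ-≡ _ _ 2 (begin
  2 ℕ.* suc (2 ℕ.* r)      ≡⟨ ℕ.*-comm 2 _ ⟩
  suc (2 ℕ.* r) ℕ.* 2      ≡⟨ eq ⟩
  4 ℕ.* k                  ≡⟨ ℕ.*-assoc 2 2 k ⟩
  2 ℕ.* (2 ℕ.* k)          ∎)))
  where open ≡-Reasoning
odd*suc≢4* r (suc (suc d)) k 2≤r k≤3 eq = from-no (15 ℕ.≤? 12) (begin
  5 ℕ.* 3                          ≤⟨ ℕ.*-mono-≤ (s≤s (ℕ.*-monoʳ-≤ 2 2≤r)) (s≤s (s≤s (s≤s z≤n))) ⟩
  suc (2 ℕ.* r) ℕ.* suc (suc (suc d)) ≡⟨ eq ⟩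
  4 ℕ.* k                          ≤⟨ ℕ.*-monoʳ-≤ 4 k≤3 ⟩
  12                               ∎)
  where open ℕ.≤-Reasoning

odd*≢-4* : ∀ {r} c {a} → 2 ℕ.≤ r → 1ℤ ≤ a → a ≤ + 3 → + suc (2 ℕ.* r) * c ≢ - (+ 4 * a)
odd*≢-4* {r} (+ e) {+ suc k} _ (+≤+ _) _ eq with trans (pos-* (suc (2 ℕ.* r)) e) eq
... | ()
odd*≢-4* (+ e) {+ zero} _ (+≤+ ()) _
odd*≢-4* {r} -[1+ d ] {+ k} 2≤r _ (+≤+ k≤3) eq =
  odd*suc≢4* r d k 2≤r k≤3 (trans (sym (abs-* (+ suc (2 ℕ.* r)) -[1+ d ])) (trans (cong ∣_∣ eq) (trans (∣-i∣≡∣i∣ (+ 4 * + k)) (abs-* (+ 4) (+ k)))))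

p+m≡6×p-m≡2⇒p≡4×m≡2 : ∀ {p m} → p + m ≡ + 6 → p - m ≡ + 2 → p ≡ + 4 × m ≡ + 2
p+m≡6×p-m≡2⇒p≡4×m≡2 {p} {m} p+m≡6 p-m≡2 = p≡4 , m≡2
  where
  double : ∀ p m → + 2 * p ≡ (p + m) + (p - m)
  double = solve-∀
  difference : ∀ p m → m ≡ (p + m) - p
  difference = solve-∀
  p≡4 : p ≡ + 4
  p≡4 = *-cancelˡ-≡ (+ 2) p (+ 4) (trans (double p m) (cong₂ _+_ p+m≡6 p-m≡2))
  m≡2 : m ≡ + 2
  m≡2 = trans (difference p m) (cong₂ _-_ p+m≡6 p≡4)

even≥11⇒7+odd : ∀ {n} → 11 ℕ.≤ n → 2 ℕ.∣ n → ∃ λ r → 2 ℕ.≤ r × n ≡ 7 ℕ.+ suc (2 ℕ.* r)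
even≥11⇒7+odd 11≤n (ℕ.divides q refl) with ℕ.*-cancelʳ-< 2 5 q 11≤n
... | s≤s (s≤s (s≤s (s≤s (s≤s (s≤s {n = q′} _))))) = 2 ℕ.+ q′ , s≤s (s≤s z≤n) , regroup q′
  where
  regroup : ∀ q′ → (6 ℕ.+ q′) ℕ.* 2 ≡ 7 ℕ.+ suc (2 ℕ.* (2 ℕ.+ q′))
  regroup = ℕS.solve-∀

a-range : ∀ {a} → 0ℤ ≤ a → a ≤ + 3 → a ≡ + 0 ⊎ a ≡ + 1 ⊎ a ≡ + 2 ⊎ a ≡ + 3
a-range {+ 0}                     _ _ = inj₁ refl
a-range {+ 1}                     _ _ = inj₂ (inj₁ refl)
a-range {+ 2}                     _ _ = inj₂ (inj₂ (inj₁ refl))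
a-range {+ 3}                     _ _ = inj₂ (inj₂ (inj₂ refl))
a-range {+ suc (suc (suc (suc _)))} _ (+≤+ (s≤s (s≤s (s≤s ()))))
a-range { -[1+ _ ]}               () _

b-range : ∀ {b} → - + 2 ≤ b → b ≤ 0ℤ → b ≢ -1ℤ → b ≡ - + 2 ⊎ b ≡ + 0
b-range {+ 0}                 _ _ _ = inj₂ refl
b-range {+ suc _}             _ (+≤+ ()) _
b-range { -[1+ 0 ]}           _ _ b≢-1 = ⊥-elim (b≢-1 refl)
b-range { -[1+ 1 ]}           _ _ _ = inj₁ refl
b-range { -[1+ suc (suc _) ]} (-≤- (s≤s ())) _ _

row-identity⇒odd*c≡-4a : ∀ {m a c} → + 4 + c * + 6 + c * 1ℤ ≡ + 6 * 1ℤ + a * + 4 + -1ℤ * + 2 + (+ 7 + m) * c →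
                         m * c ≡ - (+ 4 * a)
row-identity⇒odd*c≡-4a {m} {a} {c} row = begin
  m * c                              ≡⟨ expand a c m ⟩
  rhs - lhs - + 4 * a                ≡⟨ cong (λ t → t - lhs - + 4 * a) row ⟨
  lhs - lhs - + 4 * a                ≡⟨ cancel lhs (+ 4 * a) ⟩
  - (+ 4 * a)                        ∎
  where
  open ≡-Reasoning
  lhs = + 4 + c * + 6 + c * 1ℤ
  rhs = + 6 * 1ℤ + a * + 4 + -1ℤ * + 2 + (+ 7 + m) * c
  expand : ∀ a c m → m * c ≡ (+ 6 * 1ℤ + a * + 4 + -1ℤ * + 2 + (+ 7 + m) * c) - (+ 4 + c * + 6 + c * 1ℤ) - + 4 * a
  expand = solve-∀
  cancel : ∀ x y → x - x - y ≡ - y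
  cancel = solve-∀

module _ {n : ℕ} (G : SignedGraph n) where
  open SignedGraph G

  Matrix : Set
  Matrix = Fin n → Fin n → ℤ

  infixl 7 _⋆_
  _⋆_ : Matrix → Matrix → Matrix
  (M ⋆ N) i j = ∑[ k < n ] (M i k * N k j)

  A⁺ A⁻ ∣A∣ : Matrix
  A⁺ i j = A i j ⁺
  A⁻ i j = A i j ⁻
  ∣A∣ i j = + ∣ A i j ∣

  entryAt : ∀ i j → Entry (A i j)
  entryAt i j = entry (entries i j)

  Adj-sym : ∀ {i j} → Adj G i j → Adj G j i
  Adj-sym i~j = i~j ∘ trans (symm _ _)

  PosEdge⇒Adj : ∀ {i j} → PosEdge G i j → Adj G i j
  PosEdge⇒Adj ij≡1 ij≡0 with trans (sym ij≡1) ij≡0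
  ... | ()

  NegEdge⇒Adj : ∀ {i j} → NegEdge G i j → Adj G i j
  NegEdge⇒Adj ij≡-1 ij≡0 with trans (sym ij≡-1) ij≡0
  ... | ()

  A²≡A⋆A : ∀ i j → A² G i j ≡ (A ⋆ A) i j
  A²≡A⋆A i j = sumFin≡sum n (λ k → A i k * A k j)

  A⋆A≤A⁺⋆A⁺+A⁻⋆A⁻ : ∀ i j → (A ⋆ A) i j ≤ (A⁺ ⋆ A⁺) i j + (A⁻ ⋆ A⁻) i j
  A⋆A≤A⁺⋆A⁺+A⁻⋆A⁻ i j = ≤-trans (sum-mono-≤ (λ k → *≤⁺*⁺+⁻*⁻ (A i k) (A k j)))
    (≤-reflexive (∑-distrib-+ (λ k → A⁺ i k * A⁺ k j) (λ k → A⁻ i k * A⁻ k j)))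

  -[A⁺⋆A⁻+A⁻⋆A⁺]≤A⋆A : ∀ i j → - ((A⁺ ⋆ A⁻) i j + (A⁻ ⋆ A⁺) i j) ≤ (A ⋆ A) i j
  -[A⁺⋆A⁻+A⁻⋆A⁺]≤A⋆A i j = begin
    - ((A⁺ ⋆ A⁻) i j + (A⁻ ⋆ A⁺) i j)  ≡⟨ cong -_ (∑-distrib-+ mixed₁ mixed₂) ⟨
    - sum (λ k → mixed₁ k + mixed₂ k)   ≡⟨ sum-neg (λ k → mixed₁ k + mixed₂ k) ⟨
    sum (λ k → - (mixed₁ k + mixed₂ k)) ≤⟨ sum-mono-≤ (λ k → -⁺*⁻+⁻*⁺≤* (A i k) (A k j)) ⟩
    (A ⋆ A) i j                         ∎
    where
    open ≤-Reasoning
    mixed₁ mixed₂ : Fin n → ℤ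
    mixed₁ k = A⁺ i k * A⁻ k j
    mixed₂ k = A⁻ i k * A⁺ k j

  ∑A⁺*<∑ : ∀ i (f : Fin n → ℤ) → (∀ k → 0ℤ ≤ f k) → 0ℤ < f i → ∑[ k < n ] (A⁺ i k * f k) < sum f
  ∑A⁺*<∑ i f 0≤f 0<fi = sum-mono-< (λ k → entry-⁺*≤ (entryAt i k) (0≤f k)) i
    (subst (_< f i) (cong (λ x → x ⁺ * f i) (sym (loopless i))) 0<fi)

  0≤∣A∣*∣A∣ : ∀ i k j → 0ℤ ≤ ∣A∣ i k * ∣A∣ k j
  0≤∣A∣*∣A∣ i k j = 0≤* {∣A∣ i k} {∣A∣ k j} (+≤+ z≤n) (+≤+ z≤n)

  0≤∣A∣⋆∣A∣ : ∀ i j → 0ℤ ≤ (∣A∣ ⋆ ∣A∣) i j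
  0≤∣A∣⋆∣A∣ i j = sum-nonNeg {f = λ k → ∣A∣ i k * ∣A∣ k j} (λ k → 0≤∣A∣*∣A∣ i k j)

  common-neighbour⇒1≤∣A∣⋆∣A∣ : ∀ {i j k} → Adj G i k → Adj G k j → 1ℤ ≤ (∣A∣ ⋆ ∣A∣) i j
  common-neighbour⇒1≤∣A∣⋆∣A∣ {i} {j} {k} i~k k~j =
    subst (_≤ (∣A∣ ⋆ ∣A∣) i j) (cong₂ _*_ (entry-∣∣≡1 (entryAt i k) i~k) (entry-∣∣≡1 (entryAt k j) k~j))
      (term≤sum {f = λ k → ∣A∣ i k * ∣A∣ k j} (λ k → 0≤∣A∣*∣A∣ i k j) k)

  ∣A∣*∣A∣≢0⇒common-neighbour : ∀ {i j k} → ∣A∣ i k * ∣A∣ k j ≢ 0ℤ → Adj G i k × Adj G k j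
  ∣A∣*∣A∣≢0⇒common-neighbour {i} {j} {k} ≢0 =
    (λ ik≡0 → ≢0 (cong (λ x → + ∣ x ∣ * ∣A∣ k j) ik≡0)) ,
    (λ kj≡0 → ≢0 (trans (cong (λ y → ∣A∣ i k * + ∣ y ∣) kj≡0) (*-zeroʳ (∣A∣ i k))))

  ∑∣A∣+∑∣A∣≤∣A∣⋆∣A∣+n : ∀ i j → ∑[ k < n ] ∣A∣ k j + sum (∣A∣ i) ≤ (∣A∣ ⋆ ∣A∣) i j + + n
  ∑∣A∣+∑∣A∣≤∣A∣⋆∣A∣+n i j = begin
    ∑[ k < n ] ∣A∣ k j + sum (∣A∣ i)             ≡⟨ ∑-distrib-+ (λ k → ∣A∣ k j) (∣A∣ i) ⟨
    ∑[ k < n ] (∣A∣ k j + ∣A∣ i k)               ≤⟨ sum-mono-≤ (λ k → entries-∣∣+∣∣≤∣∣*∣∣+1 (entryAt i k) (entryAt k j)) ⟩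
    ∑[ k < n ] (∣A∣ i k * ∣A∣ k j + 1ℤ)          ≡⟨ ∑-distrib-+ (λ k → ∣A∣ i k * ∣A∣ k j) (λ _ → 1ℤ) ⟩
    (∣A∣ ⋆ ∣A∣) i j + sum {n} (λ _ → 1ℤ)         ≡⟨ cong (λ t → (∣A∣ ⋆ ∣A∣) i j + t) (trans (sum-const n 1ℤ) (*-identityʳ (+ n))) ⟩
    (∣A∣ ⋆ ∣A∣) i j + + n                        ∎
    where open ≤-Reasoning

  ∑A⋆A≡ρ*ρ : ∀ {ρ} → NetRegular G ρ → ∀ i → sum ((A ⋆ A) i) ≡ ρ * ρ
  ∑A⋆A≡ρ*ρ {ρ} netRegular i = begin
    ∑[ j < n ] ∑[ k < n ] (A i k * A k j)  ≡⟨ ∑-comm (λ j k → A i k * A k j) ⟩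
    ∑[ k < n ] ∑[ j < n ] (A i k * A k j)  ≡⟨ sum-cong-≗ (λ k → *-distribˡ-sum (A i k) (A k)) ⟨
    ∑[ k < n ] (A i k * sum (A k))       ≡⟨ sum-cong-≗ (λ k → cong (A i k *_) (rowSum k)) ⟩
    ∑[ k < n ] (A i k * ρ)               ≡⟨ *-distribʳ-sum ρ (A i) ⟨
    sum (A i) * ρ                        ≡⟨ cong (_* ρ) (rowSum i) ⟩
    ρ * ρ                                ∎
    where
    open ≡-Reasoning
    rowSum : ∀ k → sum (A k) ≡ ρ
    rowSum k = trans (sym (sumFin≡sum n (A k))) (netRegular k)

  ∑A⁺*[A⁻⋆A⁻]≡∑A⁻*[A⁺⋆A⁻] : ∀ i → ∑[ p < n ] (A⁺ i p * (A⁻ ⋆ A⁻) i p) ≡ ∑[ k < n ] (A⁻ i k * (A⁺ ⋆ A⁻) i k)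
  ∑A⁺*[A⁻⋆A⁻]≡∑A⁻*[A⁺⋆A⁻] i = begin
    ∑[ p < n ] (A⁺ i p * (A⁻ ⋆ A⁻) i p)                ≡⟨ sum-cong-≗ (λ p → *-distribˡ-sum (A⁺ i p) (λ k → A⁻ i k * A⁻ k p)) ⟩
    ∑[ p < n ] ∑[ k < n ] (A⁺ i p * (A⁻ i k * A⁻ k p)) ≡⟨ ∑-comm (λ p k → A⁺ i p * (A⁻ i k * A⁻ k p)) ⟩
    ∑[ k < n ] ∑[ p < n ] (A⁺ i p * (A⁻ i k * A⁻ k p)) ≡⟨ sum-cong-≗ (λ k → sum-cong-≗ (λ p → swap k p)) ⟩
    ∑[ k < n ] ∑[ p < n ] (A⁻ i k * (A⁺ i p * A⁻ p k)) ≡⟨ sum-cong-≗ (λ k → *-distribˡ-sum (A⁻ i k) (λ p → A⁺ i p * A⁻ p k)) ⟨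
    ∑[ k < n ] (A⁻ i k * (A⁺ ⋆ A⁻) i k)                ∎
    where
    open ≡-Reasoning
    swap : ∀ k p → A⁺ i p * (A⁻ i k * A⁻ k p) ≡ A⁻ i k * (A⁺ i p * A⁻ p k)
    swap k p = trans (cong (λ t → A⁺ i p * (A⁻ i k * t ⁻)) (symm k p)) (x*[y*z]≡y*[x*z] (A⁺ i p) (A⁻ i k) (A⁻ p k))

  A⁻⋆A⁺≡[A⁺⋆A⁻]ᵀ : ∀ i j → (A⁻ ⋆ A⁺) i j ≡ (A⁺ ⋆ A⁻) j i
  A⁻⋆A⁺≡[A⁺⋆A⁻]ᵀ i j = sum-cong-≗ λ k →
    trans (*-comm (A⁻ i k) (A⁺ k j)) (cong₂ (λ x y → x ⁺ * y ⁻) (symm k j) (symm i k))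

  ∑∣A∣≡∑A⁺+∑A⁻ : ∀ i → sum (∣A∣ i) ≡ sum (A⁺ i) + sum (A⁻ i)
  ∑∣A∣≡∑A⁺+∑A⁻ i = trans (sum-cong-≗ (λ j → ∣∣≡⁺+⁻ (A i j))) (∑-distrib-+ (A⁺ i) (A⁻ i))

  ∑A≡∑A⁺-∑A⁻ : ∀ i → sum (A i) ≡ sum (A⁺ i) - sum (A⁻ i)
  ∑A≡∑A⁺-∑A⁻ i = begin
    sum (A i)                           ≡⟨ sum-cong-≗ (λ j → ≡⁺-⁻ (A i j)) ⟩
    ∑[ j < n ] (A⁺ i j - A⁻ i j)        ≡⟨ ∑-distrib-+ (A⁺ i) (λ j → - A⁻ i j) ⟩
    sum (A⁺ i) + ∑[ j < n ] (- A⁻ i j)  ≡⟨ cong (_+_ (sum (A⁺ i))) (sum-neg (A⁻ i)) ⟩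
    sum (A⁺ i) - sum (A⁻ i)             ∎
    where open ≡-Reasoning

  ⟪_,_⟫ : Matrix → Matrix → ℤ
  ⟪ M , N ⟫ = ∑[ i < n ] ∑[ j < n ] (M i j * N i j)

  ⟪A⁻,A⁺⋆A⁻⟫≡⟪A⁻,A⁻⋆A⁺⟫ : ⟪ A⁻ , A⁺ ⋆ A⁻ ⟫ ≡ ⟪ A⁻ , A⁻ ⋆ A⁺ ⟫
  ⟪A⁻,A⁺⋆A⁻⟫≡⟪A⁻,A⁻⋆A⁺⟫ = trans (∑-comm (λ i j → A⁻ i j * (A⁺ ⋆ A⁻) i j))
    (sum-cong-≗ λ j → sum-cong-≗ λ i →
      cong₂ _*_ (cong _⁻ (symm i j)) (sym (A⁻⋆A⁺≡[A⁺⋆A⁻]ᵀ j i)))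

  -- For fixed i the summand counts pairs of negative edges ij, ik closed by a positive edge jk.
  2∣⟪A⁻,A⁻⋆A⁺⟫ : + 2 ∣ ⟪ A⁻ , A⁻ ⋆ A⁺ ⟫
  2∣⟪A⁻,A⁻⋆A⁺⟫ = ∣-sum λ i →
    subst (+ 2 ∣_) (sum-cong-≗ (λ j → sym (*-distribˡ-sum (A⁻ i j) (λ k → A⁻ i k * A⁺ k j))))
      (2∣sum-symmetric (R i) (R-symmetric i) (R-hollow i))
    where
    R : Fin n → Matrix
    R i j k = A⁻ i j * (A⁻ i k * A⁺ k j)
    R-symmetric : ∀ i j k → R i j k ≡ R i k j
    R-symmetric i j k = trans (cong (λ x → A⁻ i j * (A⁻ i k * x ⁺)) (symm k j)) (x*[y*z]≡y*[x*z] (A⁻ i j) (A⁻ i k) (A⁺ j k))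
    R-hollow : ∀ i j → R i j j ≡ 0ℤ
    R-hollow i j = trans (cong (λ x → A⁻ i j * (A⁻ i j * x ⁺)) (loopless j)) (trans (cong (A⁻ i j *_) (*-zeroʳ (A⁻ i j))) (*-zeroʳ (A⁻ i j)))

  module _ (balanced : TrianglesBalanced G) where

    walk-sign : ∀ {i j} → Adj G i j → ∀ k → A i k * A k j ≡ A i j * (∣A∣ i k * ∣A∣ k j)
    walk-sign {i} {j} i~j k = balanced-walk {A i j} (entryAt i k) (entryAt k j) (entry-unit² (entryAt i j) i~j) triangle
      where
      triangle : A i k ≢ 0ℤ → A k j ≢ 0ℤ → A i j * A k j * A i k ≡ 1ℤ
      triangle i~k k~j = subst₂ (λ y z → A i j * y * z ≡ 1ℤ) (symm j k) (symm k i)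
        (balanced i j k i~j (Adj-sym k~j) (Adj-sym i~k))

    A⋆A≡A*[∣A∣⋆∣A∣] : ∀ {i j} → Adj G i j → (A ⋆ A) i j ≡ A i j * (∣A∣ ⋆ ∣A∣) i j
    A⋆A≡A*[∣A∣⋆∣A∣] {i} {j} i~j =
      trans (sum-cong-≗ (walk-sign i~j)) (sym (*-distribˡ-sum (A i j) (λ k → ∣A∣ i k * ∣A∣ k j)))

    ∣A∣⋆∣A∣≡A⁺⋆A⁻+A⁻⋆A⁺ : ∀ {i j} → NegEdge G i j → (∣A∣ ⋆ ∣A∣) i j ≡ (A⁺ ⋆ A⁻) i j + (A⁻ ⋆ A⁺) i j
    ∣A∣⋆∣A∣≡A⁺⋆A⁻+A⁻⋆A⁺ {i} {j} ij≡-1 = trans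
      (sum-cong-≗ λ k → entries-opposite (entryAt i k) (entryAt k j)
        (trans (walk-sign (NegEdge⇒Adj ij≡-1) k) (cong (_* (∣A∣ i k * ∣A∣ k j)) ij≡-1)))
      (∑-distrib-+ (λ k → A⁺ i k * A⁻ k j) (λ k → A⁻ i k * A⁺ k j))

    ∣A∣⋆∣A∣≡a : ∀ {a} → (∀ i j → PosEdge G i j → A² G i j ≡ a) →
                ∀ {i j} → PosEdge G i j → (∣A∣ ⋆ ∣A∣) i j ≡ a
    ∣A∣⋆∣A∣≡a {a} posA {i} {j} ij≡1 = begin
      (∣A∣ ⋆ ∣A∣) i j          ≡⟨ *-identityˡ _ ⟨
      1ℤ * (∣A∣ ⋆ ∣A∣) i j     ≡⟨ cong (_* (∣A∣ ⋆ ∣A∣) i j) ij≡1 ⟨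
      A i j * (∣A∣ ⋆ ∣A∣) i j  ≡⟨ A⋆A≡A*[∣A∣⋆∣A∣] (PosEdge⇒Adj ij≡1) ⟨
      (A ⋆ A) i j              ≡⟨ A²≡A⋆A i j ⟨
      A² G i j                 ≡⟨ posA i j ij≡1 ⟩
      a                        ∎
      where open ≡-Reasoning

    -[∣A∣⋆∣A∣]≡b : ∀ {b} → (∀ i j → NegEdge G i j → A² G i j ≡ b) →
                   ∀ {i j} → NegEdge G i j → - (∣A∣ ⋆ ∣A∣) i j ≡ b
    -[∣A∣⋆∣A∣]≡b {b} negA {i} {j} ij≡-1 = begin
      - (∣A∣ ⋆ ∣A∣) i j        ≡⟨ -1*i≡-i _ ⟨
      -1ℤ * (∣A∣ ⋆ ∣A∣) i j    ≡⟨ cong (_* (∣A∣ ⋆ ∣A∣) i j) ij≡-1 ⟨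
      A i j * (∣A∣ ⋆ ∣A∣) i j  ≡⟨ A⋆A≡A*[∣A∣⋆∣A∣] (NegEdge⇒Adj ij≡-1) ⟨
      (A ⋆ A) i j              ≡⟨ A²≡A⋆A i j ⟨
      A² G i j                 ≡⟨ negA i j ij≡-1 ⟩
      b                        ∎
      where open ≡-Reasoning

    a≡0⇒no-common-neighbour : ∀ {a} → (∀ i j → PosEdge G i j → A² G i j ≡ a) → a ≡ 0ℤ →
                              ∀ i j → PosEdge G i j → NoCommonNeighbour G i j
    a≡0⇒no-common-neighbour posA a≡0 i j ij≡1 k (i~k , j~k) = 1≰0
      (subst (1ℤ ≤_) (trans (∣A∣⋆∣A∣≡a posA ij≡1) a≡0) (common-neighbour⇒1≤∣A∣⋆∣A∣ i~k (Adj-sym j~k)))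

    b≡0⇒no-common-neighbour : ∀ {b} → (∀ i j → NegEdge G i j → A² G i j ≡ b) → b ≡ 0ℤ →
                              ∀ i j → NegEdge G i j → NoCommonNeighbour G i j
    b≡0⇒no-common-neighbour negA b≡0 i j ij≡-1 k (i~k , j~k) = 1≰0
      (subst (1ℤ ≤_) (neg-injective (trans (-[∣A∣⋆∣A∣]≡b negA ij≡-1) b≡0)) (common-neighbour⇒1≤∣A∣⋆∣A∣ i~k (Adj-sym j~k)))

  srsg-row-entry : ∀ {r a b c} → (∀ i → A² G i i ≡ + r) →
                   (∀ i j → PosEdge G i j → A² G i j ≡ a) → (∀ i j → NegEdge G i j → A² G i j ≡ b) →
                   (∀ i j → i ≢ j → ¬ Adj G i j → A² G i j ≡ c) →
                   ∀ i j → (A ⋆ A) i j + c * ∣A∣ i j + c * δ i j ≡ + r * δ i j + a * A⁺ i j + b * A⁻ i j + c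
  srsg-row-entry {r} {a} {b} {c} diag posA negA nonA i j = by-cases (i ≟ᶠ j)
    where
    RowEntry : Fin n → ℤ → Set
    RowEntry j d = (A ⋆ A) i j + c * ∣A∣ i j + c * d ≡ + r * d + a * A⁺ i j + b * A⁻ i j + c
    diagonal : RowEntry i 1ℤ
    diagonal = subst (λ x → (A ⋆ A) i i + c * + ∣ x ∣ + c * 1ℤ ≡ + r * 1ℤ + a * x ⁺ + b * x ⁻ + c) (sym (loopless i))
      (trans (cong (λ t → t + c * 0ℤ + c * 1ℤ) (trans (sym (A²≡A⋆A i i)) (diag i))) (identity (+ r) a b c))
      where identity : ∀ r a b c → r + c * 0ℤ + c * 1ℤ ≡ r * 1ℤ + a * 0ℤ + b * 0ℤ + c
            identity = solve-∀
    off-diagonal : ∀ {j} → i ≢ j → RowEntry j 0ℤ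
    off-diagonal {j} i≢j = begin
      (A ⋆ A) i j + c * ∣A∣ i j + c * 0ℤ      ≡⟨ identity ((A ⋆ A) i j + c * ∣A∣ i j) c ⟩
      (A ⋆ A) i j + c * ∣A∣ i j               ≡⟨ entry-decomposition (entryAt i j)
                                                  (λ ij≡0 → trans (sym (A²≡A⋆A i j)) (nonA i j i≢j (λ i~j → i~j ij≡0)))
                                                  (λ ij≡1 → trans (sym (A²≡A⋆A i j)) (posA i j ij≡1))
                                                  (λ ij≡-1 → trans (sym (A²≡A⋆A i j)) (negA i j ij≡-1)) ⟩
      a * A⁺ i j + b * A⁻ i j + c             ≡⟨ identity′ (+ r) (a * A⁺ i j) (b * A⁻ i j) c ⟩
      + r * 0ℤ + a * A⁺ i j + b * A⁻ i j + c  ∎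
      where
      open ≡-Reasoning
      identity : ∀ x c → x + c * 0ℤ ≡ x
      identity = solve-∀
      identity′ : ∀ r x y c → x + y + c ≡ r * 0ℤ + x + y + c
      identity′ = solve-∀
    by-cases : Dec (i ≡ j) → RowEntry j (δ i j)
    by-cases (yes refl) = subst (RowEntry i) (sym (δ-diag i)) diagonal
    by-cases (no i≢j)   = subst (RowEntry j) (sym (δ-offdiag i≢j)) (off-diagonal i≢j)

  module _ (regular : Regular G 6) (netRegular : NetRegular G (+ 2)) where

    degree≡6 : ∀ i → sum (∣A∣ i) ≡ + 6
    degree≡6 i = trans (sym (sumFin≡sum n (∣A∣ i))) (regular i)

    degree⁺≡4×degree⁻≡2 : ∀ i → sum (A⁺ i) ≡ + 4 × sum (A⁻ i) ≡ + 2
    degree⁺≡4×degree⁻≡2 i = p+m≡6×p-m≡2⇒p≡4×m≡2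
      (trans (sym (∑∣A∣≡∑A⁺+∑A⁻ i)) (degree≡6 i))
      (trans (sym (∑A≡∑A⁺-∑A⁻ i)) (trans (sym (sumFin≡sum n (A i))) (netRegular i)))

    degree⁺≡4 : ∀ i → sum (A⁺ i) ≡ + 4
    degree⁺≡4 i = proj₁ (degree⁺≡4×degree⁻≡2 i)

    degree⁻≡2 : ∀ i → sum (A⁻ i) ≡ + 2
    degree⁻≡2 i = proj₂ (degree⁺≡4×degree⁻≡2 i)

    ∃-positive-neighbour : ∀ i → ∃ (PosEdge G i)
    ∃-positive-neighbour i with sum≢0⇒∃≢0 {f = A⁺ i} (λ sum≡0 → +4≢0 (trans (sym (degree⁺≡4 i)) sum≡0))
      where +4≢0 : + 4 ≢ 0ℤ
            +4≢0 ()
    ... | j , A⁺ij≢0 = j , entry-⁺≢0 (entryAt i j) A⁺ij≢0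

    ∃-negative-neighbour : ∀ i → ∃ (NegEdge G i)
    ∃-negative-neighbour i with sum≢0⇒∃≢0 {f = A⁻ i} (λ sum≡0 → +2≢0 (trans (sym (degree⁻≡2 i)) sum≡0))
      where +2≢0 : + 2 ≢ 0ℤ
            +2≢0 ()
    ... | j , A⁻ij≢0 = j , entry-⁻≢0 (entryAt i j) A⁻ij≢0

    A⁺⋆A⁺≤3 : ∀ {i j} → PosEdge G i j → (A⁺ ⋆ A⁺) i j ≤ + 3
    A⁺⋆A⁺≤3 {i} {j} ij≡1 = i<j⇒i≤pred[j] (subst ((A⁺ ⋆ A⁺) i j <_) column-degree
      (∑A⁺*<∑ i (λ k → A⁺ k j) (λ k → 0≤⁺ (A k j)) (subst (0ℤ <_) (cong _⁺ (sym ij≡1)) (+<+ (s≤s z≤n)))))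
      where
      column-degree : ∑[ k < n ] A⁺ k j ≡ + 4
      column-degree = trans (sum-cong-≗ (λ k → cong _⁺ (symm k j))) (degree⁺≡4 j)

    A⁺⋆A⁻≤1 : ∀ {i j} → NegEdge G i j → (A⁺ ⋆ A⁻) i j ≤ 1ℤ
    A⁺⋆A⁻≤1 {i} {j} ij≡-1 = i<j⇒i≤pred[j] (subst ((A⁺ ⋆ A⁻) i j <_) column-degree
      (∑A⁺*<∑ i (λ k → A⁻ k j) (λ k → 0≤⁻ (A k j)) (subst (0ℤ <_) (cong _⁻ (sym ij≡-1)) (+<+ (s≤s z≤n)))))
      where
      column-degree : ∑[ k < n ] A⁻ k j ≡ + 2
      column-degree = trans (sum-cong-≗ (λ k → cong _⁻ (symm k j))) (degree⁻≡2 j)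

    4a≤14 : ∀ {a} → (∀ i j → PosEdge G i j → A² G i j ≡ a) → Fin n → + 4 * a ≤ + 14
    4a≤14 {a} posA i = begin
      + 4 * a                                             ≡⟨ cong (_* a) (degree⁺≡4 i) ⟨
      sum (A⁺ i) * a                                      ≡⟨ *-distribʳ-sum a (A⁺ i) ⟩
      ∑[ p < n ] (A⁺ i p * a)                             ≡⟨ sum-cong-≗ (λ p → entry-⁺-guard-≡ (entryAt i p) (a≡A⋆A p)) ⟩
      ∑[ p < n ] (A⁺ i p * (A ⋆ A) i p)                   ≤⟨ sum-mono-≤ (λ p → *-monoˡ-≤-nonNeg (A⁺ i p) {{nonNegative (0≤⁺ (A i p))}} (A⋆A≤A⁺⋆A⁺+A⁻⋆A⁻ i p)) ⟩
      ∑[ p < n ] (A⁺ i p * ((A⁺ ⋆ A⁺) i p + (A⁻ ⋆ A⁻) i p)) ≡⟨ sum-cong-≗ (λ p → *-distribˡ-+ (A⁺ i p) _ _) ⟩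
      ∑[ p < n ] (A⁺ i p * (A⁺ ⋆ A⁺) i p + A⁺ i p * (A⁻ ⋆ A⁻) i p) ≡⟨ ∑-distrib-+ (λ p → A⁺ i p * (A⁺ ⋆ A⁺) i p) (λ p → A⁺ i p * (A⁻ ⋆ A⁻) i p) ⟩
      ∑[ p < n ] (A⁺ i p * (A⁺ ⋆ A⁺) i p) + ∑[ p < n ] (A⁺ i p * (A⁻ ⋆ A⁻) i p) ≤⟨ +-mono-≤ positive-triangles negative-triangles ⟩
      + 14                                                ∎
      where
      open ≤-Reasoning
      a≡A⋆A : ∀ p → PosEdge G i p → a ≡ (A ⋆ A) i p
      a≡A⋆A p ip≡1 = trans (sym (posA i p ip≡1)) (A²≡A⋆A i p)
      positive-triangles : ∑[ p < n ] (A⁺ i p * (A⁺ ⋆ A⁺) i p) ≤ + 12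
      positive-triangles = begin
        ∑[ p < n ] (A⁺ i p * (A⁺ ⋆ A⁺) i p) ≤⟨ sum-mono-≤ (λ p → entry-⁺-guard-≤ (entryAt i p) A⁺⋆A⁺≤3) ⟩
        ∑[ p < n ] (A⁺ i p * + 3)           ≡⟨ *-distribʳ-sum (+ 3) (A⁺ i) ⟨
        sum (A⁺ i) * + 3                    ≡⟨ cong (_* + 3) (degree⁺≡4 i) ⟩
        + 12                                ∎
      negative-triangles : ∑[ p < n ] (A⁺ i p * (A⁻ ⋆ A⁻) i p) ≤ + 2
      negative-triangles = begin
        ∑[ p < n ] (A⁺ i p * (A⁻ ⋆ A⁻) i p) ≡⟨ ∑A⁺*[A⁻⋆A⁻]≡∑A⁻*[A⁺⋆A⁻] i ⟩
        ∑[ k < n ] (A⁻ i k * (A⁺ ⋆ A⁻) i k) ≤⟨ sum-mono-≤ (λ k → entry-⁻-guard-≤ (entryAt i k) A⁺⋆A⁻≤1) ⟩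
        ∑[ k < n ] (A⁻ i k * 1ℤ)            ≡⟨ *-distribʳ-sum 1ℤ (A⁻ i) ⟨
        sum (A⁻ i) * 1ℤ                     ≡⟨ cong (_* 1ℤ) (degree⁻≡2 i) ⟩
        + 2                                 ∎

    -2≤b : ∀ {b} → (∀ i j → NegEdge G i j → A² G i j ≡ b) → Fin n → - + 2 ≤ b
    -2≤b {b} negA i with ∃-negative-neighbour i
    ... | q , iq≡-1 = begin
      - (1ℤ + 1ℤ)                        ≤⟨ neg-mono-≤ (+-mono-≤ (A⁺⋆A⁻≤1 iq≡-1) A⁻⋆A⁺≤1) ⟩
      - ((A⁺ ⋆ A⁻) i q + (A⁻ ⋆ A⁺) i q)  ≤⟨ -[A⁺⋆A⁻+A⁻⋆A⁺]≤A⋆A i q ⟩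
      (A ⋆ A) i q                        ≡⟨ A²≡A⋆A i q ⟨
      A² G i q                           ≡⟨ negA i q iq≡-1 ⟩
      b                                  ∎
      where
      open ≤-Reasoning
      A⁻⋆A⁺≤1 : (A⁻ ⋆ A⁺) i q ≤ 1ℤ
      A⁻⋆A⁺≤1 = subst (_≤ 1ℤ) (sym (A⁻⋆A⁺≡[A⁺⋆A⁻]ᵀ i q)) (A⁺⋆A⁻≤1 (trans (symm q i) iq≡-1))

    0≤a : TrianglesBalanced G → ∀ {a} → (∀ i j → PosEdge G i j → A² G i j ≡ a) → Fin n → 0ℤ ≤ a
    0≤a balanced posA i with ∃-positive-neighbour i
    ... | j , ij≡1 = subst (0ℤ ≤_) (∣A∣⋆∣A∣≡a balanced posA ij≡1) (0≤∣A∣⋆∣A∣ i j)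

    b≤0 : TrianglesBalanced G → ∀ {b} → (∀ i j → NegEdge G i j → A² G i j ≡ b) → Fin n → b ≤ 0ℤ
    b≤0 balanced negA i with ∃-negative-neighbour i
    ... | j , ij≡-1 = subst (_≤ 0ℤ) (-[∣A∣⋆∣A∣]≡b balanced negA ij≡-1) (neg-mono-≤ (0≤∣A∣⋆∣A∣ i j))

    a≤3 : ∀ {a} → (∀ i j → PosEdge G i j → A² G i j ≡ a) → Fin n → a ≤ + 3
    a≤3 {a} posA i = i<j⇒i≤pred[j] {j = + 4} (*-cancelˡ-<-nonNeg (+ 4) (≤-<-trans (4a≤14 posA i) (+<+ (ℕ.n≤1+n 15))))

    module _ (one-common-neighbour : ∀ {i j} → NegEdge G i j → (∣A∣ ⋆ ∣A∣) i j ≡ 1ℤ) where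

      11≤n : Fin n → 11 ℕ.≤ n
      11≤n i with ∃-negative-neighbour i
      ... | q , iq≡-1 = ℕ.s≤s⁻¹ (drop‿+≤+ (subst₂ _≤_
        (cong₂ _+_ column-degree (degree≡6 i)) (cong (_+ + n) (one-common-neighbour iq≡-1))
        (∑∣A∣+∑∣A∣≤∣A∣⋆∣A∣+n i q)))
        where
        column-degree : ∑[ k < n ] ∣A∣ k q ≡ + 6
        column-degree = trans (sum-cong-≗ (λ k → cong (λ x → + ∣ x ∣) (symm k q))) (degree≡6 q)

      module _ (balanced : TrianglesBalanced G) where

        1≤a : ∀ {a} → (∀ i j → PosEdge G i j → A² G i j ≡ a) → Fin n → 1ℤ ≤ a
        1≤a posA i with ∃-negative-neighbour i
        ... | q , iq≡-1 with sum≢0⇒∃≢0 {f = λ k → ∣A∣ i k * ∣A∣ k q} (λ sum≡0 → 1≢0 (trans (sym (one-common-neighbour iq≡-1)) sum≡0))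
          where 1≢0 : 1ℤ ≢ 0ℤ
                1≢0 ()
        ... | k , ≢0 with ∣A∣*∣A∣≢0⇒common-neighbour ≢0
        ... | i~k , k~q with entries-*≡-1 (entryAt i k) (entryAt k q)
               (trans (walk-sign balanced (NegEdge⇒Adj iq≡-1) k)
                 (cong₂ _*_ iq≡-1 (cong₂ _*_ (entry-∣∣≡1 (entryAt i k) i~k) (entry-∣∣≡1 (entryAt k q) k~q))))
        ... | inj₁ ik≡1 = subst (1ℤ ≤_) (∣A∣⋆∣A∣≡a balanced posA ik≡1)
                            (common-neighbour⇒1≤∣A∣⋆∣A∣ (NegEdge⇒Adj iq≡-1) (Adj-sym k~q))
        ... | inj₂ kq≡1 = subst (1ℤ ≤_) (∣A∣⋆∣A∣≡a balanced posA kq≡1)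
                            (common-neighbour⇒1≤∣A∣⋆∣A∣ (Adj-sym i~k) (NegEdge⇒Adj iq≡-1))

        n*2≡2⟪A⁻,A⁻⋆A⁺⟫ : + n * + 2 ≡ ⟪ A⁻ , A⁻ ⋆ A⁺ ⟫ + ⟪ A⁻ , A⁻ ⋆ A⁺ ⟫
        n*2≡2⟪A⁻,A⁻⋆A⁺⟫ = begin
          + n * + 2                                   ≡⟨ sum-const n (+ 2) ⟨
          ∑[ i < n ] (+ 2)                            ≡⟨ sum-cong-≗ (λ i → sym (degree⁻≡2 i)) ⟩
          ∑[ i < n ] ∑[ j < n ] A⁻ i j                ≡⟨ sum-cong-≗ (λ i → sum-cong-≗ (split i)) ⟩
          ∑[ i < n ] ∑[ j < n ] (A⁻ i j * (A⁺ ⋆ A⁻) i j + A⁻ i j * (A⁻ ⋆ A⁺) i j)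
            ≡⟨ sum-cong-≗ (λ i → ∑-distrib-+ (λ j → A⁻ i j * (A⁺ ⋆ A⁻) i j) (λ j → A⁻ i j * (A⁻ ⋆ A⁺) i j)) ⟩
          ∑[ i < n ] (∑[ j < n ] (A⁻ i j * (A⁺ ⋆ A⁻) i j) + ∑[ j < n ] (A⁻ i j * (A⁻ ⋆ A⁺) i j))
            ≡⟨ ∑-distrib-+ (λ i → ∑[ j < n ] (A⁻ i j * (A⁺ ⋆ A⁻) i j)) (λ i → ∑[ j < n ] (A⁻ i j * (A⁻ ⋆ A⁺) i j)) ⟩
          ⟪ A⁻ , A⁺ ⋆ A⁻ ⟫ + ⟪ A⁻ , A⁻ ⋆ A⁺ ⟫         ≡⟨ cong (_+ ⟪ A⁻ , A⁻ ⋆ A⁺ ⟫) ⟪A⁻,A⁺⋆A⁻⟫≡⟪A⁻,A⁻⋆A⁺⟫ ⟩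
          ⟪ A⁻ , A⁻ ⋆ A⁺ ⟫ + ⟪ A⁻ , A⁻ ⋆ A⁺ ⟫         ∎
          where
          open ≡-Reasoning
          split : ∀ i j → A⁻ i j ≡ A⁻ i j * (A⁺ ⋆ A⁻) i j + A⁻ i j * (A⁻ ⋆ A⁺) i j
          split i j = begin
            A⁻ i j                                          ≡⟨ *-identityʳ (A⁻ i j) ⟨
            A⁻ i j * 1ℤ                                     ≡⟨ entry-⁻-guard-≡ (entryAt i j) (λ ij≡-1 → trans (sym (one-common-neighbour ij≡-1)) (∣A∣⋆∣A∣≡A⁺⋆A⁻+A⁻⋆A⁺ balanced ij≡-1)) ⟩
            A⁻ i j * ((A⁺ ⋆ A⁻) i j + (A⁻ ⋆ A⁺) i j)        ≡⟨ *-distribˡ-+ (A⁻ i j) _ _ ⟩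
            A⁻ i j * (A⁺ ⋆ A⁻) i j + A⁻ i j * (A⁻ ⋆ A⁺) i j ∎

        2∣n : 2 ℕ.∣ n
        2∣n = ∣⇒∣ᵤ (subst (+ 2 ∣_) (sym n≡⟪A⁻,A⁻⋆A⁺⟫) 2∣⟪A⁻,A⁻⋆A⁺⟫)
          where
          double : ∀ x → x + x ≡ x * + 2
          double = solve-∀
          n≡⟪A⁻,A⁻⋆A⁺⟫ : + n ≡ ⟪ A⁻ , A⁻ ⋆ A⁺ ⟫
          n≡⟪A⁻,A⁻⋆A⁺⟫ = *-cancelʳ-≡ (+ n) _ (+ 2) (trans n*2≡2⟪A⁻,A⁻⋆A⁺⟫ (double ⟪ A⁻ , A⁻ ⋆ A⁺ ⟫))

    row-identity : ∀ {a b c} → (∀ i → A² G i i ≡ + 6) →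
                   (∀ i j → PosEdge G i j → A² G i j ≡ a) → (∀ i j → NegEdge G i j → A² G i j ≡ b) →
                   (∀ i j → i ≢ j → ¬ Adj G i j → A² G i j ≡ c) →
                   Fin n → + 4 + c * + 6 + c * 1ℤ ≡ + 6 * 1ℤ + a * + 4 + b * + 2 + + n * c
    row-identity {a} {b} {c} diag posA negA nonA i = begin
      + 4 + c * + 6 + c * 1ℤ
        ≡⟨ cong₂ _+_ (cong₂ _+_ (∑A⋆A≡ρ*ρ netRegular i) (cong (c *_) (degree≡6 i))) (cong (c *_) (sum-δ i)) ⟨
      sum ((A ⋆ A) i) + c * sum (∣A∣ i) + c * sum (δ i)
        ≡⟨ cong₂ _+_ (cong (_+_ (sum ((A ⋆ A) i))) (*-distribˡ-sum c (∣A∣ i))) (*-distribˡ-sum c (δ i)) ⟩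
      sum ((A ⋆ A) i) + ∑[ j < n ] (c * ∣A∣ i j) + ∑[ j < n ] (c * δ i j)
        ≡⟨ cong (_+ ∑[ j < n ] (c * δ i j)) (∑-distrib-+ ((A ⋆ A) i) (λ j → c * ∣A∣ i j)) ⟨
      ∑[ j < n ] ((A ⋆ A) i j + c * ∣A∣ i j) + ∑[ j < n ] (c * δ i j)
        ≡⟨ ∑-distrib-+ (λ j → (A ⋆ A) i j + c * ∣A∣ i j) (λ j → c * δ i j) ⟨
      ∑[ j < n ] ((A ⋆ A) i j + c * ∣A∣ i j + c * δ i j)
        ≡⟨ sum-cong-≗ (srsg-row-entry diag posA negA nonA i) ⟩
      ∑[ j < n ] (+ 6 * δ i j + a * A⁺ i j + b * A⁻ i j + c)
        ≡⟨ ∑-distrib-+ (λ j → + 6 * δ i j + a * A⁺ i j + b * A⁻ i j) (λ _ → c) ⟩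
      ∑[ j < n ] (+ 6 * δ i j + a * A⁺ i j + b * A⁻ i j) + sum {n} (λ _ → c)
        ≡⟨ cong (_+ sum {n} (λ _ → c)) (∑-distrib-+ (λ j → + 6 * δ i j + a * A⁺ i j) (λ j → b * A⁻ i j)) ⟩
      ∑[ j < n ] (+ 6 * δ i j + a * A⁺ i j) + ∑[ j < n ] (b * A⁻ i j) + sum {n} (λ _ → c)
        ≡⟨ cong (λ t → t + ∑[ j < n ] (b * A⁻ i j) + sum {n} (λ _ → c)) (∑-distrib-+ (λ j → + 6 * δ i j) (λ j → a * A⁺ i j)) ⟩
      ∑[ j < n ] (+ 6 * δ i j) + ∑[ j < n ] (a * A⁺ i j) + ∑[ j < n ] (b * A⁻ i j) + sum {n} (λ _ → c)
        ≡⟨ cong₂ _+_ (cong₂ _+_ (cong₂ _+_ (sym (*-distribˡ-sum (+ 6) (δ i))) (sym (*-distribˡ-sum a (A⁺ i))))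
                               (sym (*-distribˡ-sum b (A⁻ i)))) (sum-const n c) ⟩
      + 6 * sum (δ i) + a * sum (A⁺ i) + b * sum (A⁻ i) + + n * c
        ≡⟨ cong₂ _+_ (cong₂ _+_ (cong₂ _+_ (cong (+ 6 *_) (sum-δ i)) (cong (a *_) (degree⁺≡4 i)))
                               (cong (b *_) (degree⁻≡2 i))) refl ⟩
      + 6 * 1ℤ + a * + 4 + b * + 2 + + n * c ∎
      where open ≡-Reasoning

    b≢-1 : TrianglesBalanced G → ∀ {a b c} → (∀ i → A² G i i ≡ + 6) →
           (∀ i j → PosEdge G i j → A² G i j ≡ a) → (∀ i j → NegEdge G i j → A² G i j ≡ b) →
           (∀ i j → i ≢ j → ¬ Adj G i j → A² G i j ≡ c) → Fin n → b ≢ -1ℤ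
    b≢-1 balanced {a} {b} {c} diag posA negA nonA i b≡-1 =
      no-odd-solution (even≥11⇒7+odd (11≤n one-common-neighbour i) (2∣n one-common-neighbour balanced))
      where
      one-common-neighbour : ∀ {i j} → NegEdge G i j → (∣A∣ ⋆ ∣A∣) i j ≡ 1ℤ
      one-common-neighbour ij≡-1 = neg-injective (trans (-[∣A∣⋆∣A∣]≡b balanced negA ij≡-1) b≡-1)
      row : + 4 + c * + 6 + c * 1ℤ ≡ + 6 * 1ℤ + a * + 4 + -1ℤ * + 2 + + n * c
      row = subst (λ b → + 4 + c * + 6 + c * 1ℤ ≡ + 6 * 1ℤ + a * + 4 + b * + 2 + + n * c) b≡-1
              (row-identity diag posA negA nonA i)
      no-odd-solution : ∃ (λ r → 2 ℕ.≤ r × n ≡ 7 ℕ.+ suc (2 ℕ.* r)) → ⊥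
      no-odd-solution (r , 2≤r , n≡7+odd) = odd*≢-4* c 2≤r (1≤a one-common-neighbour balanced posA i) (a≤3 posA i)
        (row-identity⇒odd*c≡-4a {+ suc (2 ℕ.* r)} {a} {c} (subst (λ m → + 4 + c * + 6 + c * 1ℤ ≡ + 6 * 1ℤ + a * + 4 + -1ℤ * + 2 + + m * c) n≡7+odd row))

lemma3p18 : {n : ℕ} (G : SignedGraph n) (a b c : ℤ) →
    (InC₁ G a b c ⊎ InC₄ G a b c ⊎ InC₅ G a b c) →
    Connected G → ¬ Complete G → Regular G 6 → NetRegular G (+ 2) →
    IsSRSG G 6 a b c → TrianglesBalanced G →
    ((a ≡ + 0 ⊎ a ≡ + 1 ⊎ a ≡ + 2 ⊎ a ≡ + 3) × (b ≡ - + 2 ⊎ b ≡ + 0))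
    × ((a ≡ + 0 → ∀ i j → PosEdge G i j → NoCommonNeighbour G i j)
     × (b ≡ + 0 → ∀ i j → NegEdge G i j → NoCommonNeighbour G i j))
lemma3p18 {zero} G a b c _ _ _ _ _ (_ , not-edgeless , _) _ = ⊥-elim (not-edgeless (λ ()))
lemma3p18 {suc n} G a b c _ _ _ regular netRegular (_ , _ , diag , posA , negA , nonA) balanced =
  ( a-range (0≤a G regular netRegular balanced posA v) (a≤3 G regular netRegular posA v)
  , b-range (-2≤b G regular netRegular negA v) (b≤0 G regular netRegular balanced negA v)
            (b≢-1 G regular netRegular balanced diag posA negA nonA v) )
  , a≡0⇒no-common-neighbour G balanced posA
  , b≡0⇒no-common-neighbour G balanced negA
  where
  v : Fin (suc n)
  v = zero
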